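{- $t(2)=2$.
   Context: Finite rooted trees are structures over a binary relation $<$ (plus equality), with $\alpha>\beta$ iff $\alpha$ is a proper ancestor of $\beta$. The depth of a rooted tree is the maximum number of nodes on a root-to-leaf path. For $r\ge 2$, $t(r)$ is the maximum integer $z$ such that there is a first-order sentence with $r$ quantifiers (occurrences of $\forall,\exists$) true in all finite rooted trees of depth $\ge z$ and false in all finite rooted trees of depth $<z$. -}

module Defs where

open import Data.Nat using (ℕ; zero; suc; _≤_; _<_; _⊔_)
open import Data.Fin using (Fin)
open import Data.Bool using (Bool; true; false; not; _∧_; _∨_; if_then_else_)
open import Data.List using (List; allFin; map; foldr; filterᵇ; length)
open import Data.Bool.ListAction using (all; any)
open import Data.Product using (Σ; _×_; _,_)
open import Data.Sum using (_⊎_)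
open import Relation.Binary.PropositionalEquality using (_≡_; _≢_)

-- Nodes are Fin size; (x <ᵗ y ≡ true) means x < y, i.e. y is a proper
-- ancestor of x.

record RootedTree : Set where
  field
    size      : ℕ
    _<ᵗ_      : Fin size → Fin size → Bool
    irrefl    : ∀ x → (x <ᵗ x) ≡ false
    trans     : ∀ x y z → (x <ᵗ y) ≡ true → (y <ᵗ z) ≡ true → (x <ᵗ z) ≡ true
    root      : Fin size
    root-top  : ∀ x → x ≢ root → (x <ᵗ root) ≡ true
    ancestors-chain : ∀ x y z → (x <ᵗ y) ≡ true → (x <ᵗ z) ≡ true →
                      y ≡ z ⊎ ((y <ᵗ z) ≡ true ⊎ (z <ᵗ y) ≡ true)

open RootedTree public

-- number of nodes on the root-to-x path = 1 + number of proper ancestors of x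
pathLength : (T : RootedTree) → Fin (size T) → ℕ
pathLength T x = suc (length (filterᵇ (λ y → _<ᵗ_ T x y) (allFin (size T))))

depth : RootedTree → ℕ
depth T = foldr _⊔_ 0 (map (pathLength T) (allFin (size T)))

data Formula (k : ℕ) : Set where
  ⊤′ ⊥′ : Formula k
  _≺_   : Fin k → Fin k → Formula k
  _≐_   : Fin k → Fin k → Formula k
  ¬′_   : Formula k → Formula k
  _∧′_ _∨′_ _⇒′_ _⇔′_ : Formula k → Formula k → Formula k
  ∀′ ∃′ : Formula (suc k) → Formula k

Sentence : Set
Sentence = Formula 0

qcount : ∀ {k} → Formula k → ℕ
qcount ⊤′ = 0
qcount ⊥′ = 0
qcount (x ≺ y) = 0
qcount (x ≐ y) = 0
qcount (¬′ φ) = qcount φ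
qcount (φ ∧′ ψ) = qcount φ Data.Nat.+ qcount ψ
qcount (φ ∨′ ψ) = qcount φ Data.Nat.+ qcount ψ
qcount (φ ⇒′ ψ) = qcount φ Data.Nat.+ qcount ψ
qcount (φ ⇔′ ψ) = qcount φ Data.Nat.+ qcount ψ
qcount (∀′ φ) = suc (qcount φ)
qcount (∃′ φ) = suc (qcount φ)

extend : ∀ {A : Set} {k} → A → (Fin k → A) → Fin (suc k) → A
extend a ρ Fin.zero = a
extend a ρ (Fin.suc i) = ρ i

eqFin : ∀ {n} → Fin n → Fin n → Bool
eqFin Fin.zero Fin.zero = true
eqFin Fin.zero (Fin.suc _) = false
eqFin (Fin.suc _) Fin.zero = false
eqFin (Fin.suc a) (Fin.suc b) = eqFin a b

eval : (T : RootedTree) → ∀ {k} → Formula k → (Fin k → Fin (size T)) → Bool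
eval T ⊤′ ρ = true
eval T ⊥′ ρ = false
eval T (x ≺ y) ρ = _<ᵗ_ T (ρ x) (ρ y)
eval T (x ≐ y) ρ = eqFin (ρ x) (ρ y)
eval T (¬′ φ) ρ = not (eval T φ ρ)
eval T (φ ∧′ ψ) ρ = eval T φ ρ ∧ eval T ψ ρ
eval T (φ ∨′ ψ) ρ = eval T φ ρ ∨ eval T ψ ρ
eval T (φ ⇒′ ψ) ρ = not (eval T φ ρ) ∨ eval T ψ ρ
eval T (φ ⇔′ ψ) ρ = if eval T φ ρ then eval T ψ ρ else not (eval T ψ ρ)
eval T (∀′ φ) ρ = all (λ a → eval T φ (extend a ρ)) (allFin (size T))
eval T (∃′ φ) ρ = any (λ a → eval T φ (extend a ρ)) (allFin (size T))

noVars : ∀ {A : Set} → Fin 0 → A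
noVars ()

_⊨_ : RootedTree → Sentence → Bool
T ⊨ φ = eval T φ noVars

DefinesDepthAtLeast : Sentence → ℕ → Set
DefinesDepthAtLeast φ z =
  ∀ (T : RootedTree) → (z ≤ depth T → (T ⊨ φ) ≡ true) × (depth T < z → (T ⊨ φ) ≡ false)

Achievable : ℕ → ℕ → Set
Achievable r z = Σ Sentence (λ φ → (qcount φ ≡ r) × DefinesDepthAtLeast φ z)

IsT : ℕ → ℕ → Set
IsT r z = Achievable r z × (∀ z′ → Achievable r z′ → z′ ≤ z)

-- The sentence ∃x∃y (y < x) says exactly that the depth is at least 2.
-- Conversely, a sentence with two quantifiers is a Boolean combination of
-- sentences ∃x ψ(x) in which ψ has at most one quantifier, so ψ is a Boolean
-- combination of a single ∃y χ(x, y) with χ quantifier-free.  In a chain with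
-- at least two nodes, ∃y χ(x, y) at an inner node x is the disjunction of its
-- values at the leaf and at the root, hence ψ(x) equals ψ(leaf) or ψ(root),
-- and ∃x ψ(x) is ψ(leaf) ∨ ψ(root).  The leaf and the root of two such chains
-- satisfy the same formulas with one quantifier, so chains of depths z - 1
-- and z cannot be separated when z ≥ 3.

module Submission where

open import Defs
open import Data.Bool using (Bool; true; false; not; _∧_; _∨_; if_then_else_; T?)
import Data.Bool as 𝔹
open import Data.Bool.Properties using (T-≡; ∨-zeroʳ; ¬-not)
open import Data.Bool.ListAction using (all; any)
open import Data.Fin using (Fin; zero; suc; toℕ; fromℕ; _≟_)
open import Data.Fin.Properties using (≤fromℕ; ≤∧≢⇒<)
import Data.Fin.Properties as Fin
open import Data.List using (List; []; _∷_; allFin; tabulate; map; foldr; filterᵇ; length)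
open import Data.List.Properties using (length-tabulate; filter-all; filter-notAll)
open import Data.List.Membership.Propositional using (_∈_; lose)
open import Data.List.Membership.Propositional.Properties using (∈-allFin)
open import Data.List.Relation.Unary.Any using (here; there; satisfied)
open import Data.List.Relation.Unary.Any.Properties using (any⁺; any⁻)
open import Data.List.Relation.Unary.All.Properties using (tabulate⁺)
open import Data.Nat using (ℕ; zero; suc; _≤_; _<_; _+_; _⊔_; _<ᵇ_; z≤n; s≤s)
open import Data.Nat.Properties
  using (≤-refl; ≤-trans; ≤-reflexive; ≤-antisym; <⇒≤; ≤⇒≯; n≤0⇒n≡0;
         m≤m⊔n; m≤n⊔m; ⊔-lub; ⊔-sel; m+n≤o⇒m≤o; m+n≤o⇒n≤o; <⇒<ᵇ; <ᵇ⇒<; <-trans)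
open import Data.Product using (∃; ∃₂; _×_; _,_; proj₁; proj₂)
import Data.Product as Product
open import Data.Sum using (_⊎_; inj₁; inj₂)
open import Function using (_∘_; flip)
open import Function.Bundles using (Equivalence)
open import Relation.Binary.Definitions using (tri<; tri≈; tri>)
open import Relation.Binary.PropositionalEquality
  using (_≡_; _≢_; refl; sym; cong; cong₂; subst; module ≡-Reasoning)
  renaming (trans to ≡-trans)
open import Relation.Nullary using (yes; no; contradiction)

open Equivalence using (to; from)

private
  variable
    A : Set

≡-from-⇔ : {x y : Bool} → (x ≡ true → y ≡ true) → (y ≡ true → x ≡ true) → x ≡ y
≡-from-⇔ {true}  {true}  _ _ = refl
≡-from-⇔ {false} {false} _ _ = refl
≡-from-⇔ {true}  {false} f _ = sym (f refl)
≡-from-⇔ {false} {true}  _ g = g refl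

∨≡true⁻ : ∀ x {y} → x ∨ y ≡ true → x ≡ true ⊎ y ≡ true
∨≡true⁻ true  _ = inj₁ refl
∨≡true⁻ false e = inj₂ e

any≡true⁺ : (f : A → Bool) {x : A} {xs : List A} → x ∈ xs → f x ≡ true → any f xs ≡ true
any≡true⁺ f x∈xs fx = to T-≡ (any⁺ f (lose x∈xs (from T-≡ fx)))

any≡true⁻ : (f : A → Bool) (xs : List A) → any f xs ≡ true → ∃ λ x → f x ≡ true
any≡true⁻ f xs e = Product.map₂ (to T-≡) (satisfied (any⁻ f xs (from T-≡ e)))

all≡not-any-not : (f : A → Bool) (xs : List A) → all f xs ≡ not (any (not ∘ f) xs)
all≡not-any-not f []       = refl
all≡not-any-not f (x ∷ xs) with f x
... | true  = all≡not-any-not f xs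
... | false = refl

filterᵇ-nonempty⁺ : (p : A → Bool) {x : A} {xs : List A} → x ∈ xs → p x ≡ true →
                    1 ≤ length (filterᵇ p xs)
filterᵇ-nonempty⁺ p {xs = y ∷ _}  (here refl) px rewrite px = s≤s z≤n
filterᵇ-nonempty⁺ p {xs = y ∷ ys} (there x∈ys) px with p y
... | true  = s≤s z≤n
... | false = filterᵇ-nonempty⁺ p x∈ys px

filterᵇ-nonempty⁻ : (p : A → Bool) (xs : List A) → 1 ≤ length (filterᵇ p xs) →
                    ∃ λ x → p x ≡ true
filterᵇ-nonempty⁻ p (x ∷ xs) le with p x in px
... | true  = x , px
... | false = filterᵇ-nonempty⁻ p xs le

module _ (f : A → ℕ) where

  ≤-foldr-⊔ : {x : A} {xs : List A} → x ∈ xs → f x ≤ foldr _⊔_ 0 (map f xs)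
  ≤-foldr-⊔ {xs = y ∷ ys} (here refl)  = m≤m⊔n (f y) _
  ≤-foldr-⊔ {xs = y ∷ ys} (there x∈ys) = ≤-trans (≤-foldr-⊔ x∈ys) (m≤n⊔m (f y) _)

  foldr-⊔-≤ : {b : ℕ} (xs : List A) → (∀ x → f x ≤ b) → foldr _⊔_ 0 (map f xs) ≤ b
  foldr-⊔-≤ []       _ = z≤n
  foldr-⊔-≤ (x ∷ xs) h = ⊔-lub (h x) (foldr-⊔-≤ xs h)

  foldr-⊔-attained : {k : ℕ} (xs : List A) → suc k ≤ foldr _⊔_ 0 (map f xs) →
                     ∃ λ x → suc k ≤ f x
  foldr-⊔-attained (x ∷ xs) le with ⊔-sel (f x) (foldr _⊔_ 0 (map f xs))
  ... | inj₁ e = x , subst (_ ≤_) e le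
  ... | inj₂ e = foldr-⊔-attained xs (subst (_ ≤_) e le)

-- Depth of a rooted tree

module _ (T : RootedTree) where

  pathLength≤depth : ∀ x → pathLength T x ≤ depth T
  pathLength≤depth x = ≤-foldr-⊔ (pathLength T) (∈-allFin x)

  -- A node is not its own ancestor, so at most size T - 1 nodes lie above it.
  pathLength≤size : ∀ x → pathLength T x ≤ size T
  pathLength≤size x = subst (pathLength T x ≤_) (length-tabulate (λ y → y))
    (filter-notAll (λ y → T? (_<ᵗ_ T x y)) (allFin (size T))
      (lose (∈-allFin x) (λ x<x → subst 𝔹.T (irrefl T x) x<x)))

  depth≤size : depth T ≤ size T
  depth≤size = foldr-⊔-≤ (pathLength T) (allFin (size T)) pathLength≤size

  edge⇒depth≥2 : ∀ {x y} → _<ᵗ_ T x y ≡ true → 2 ≤ depth T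
  edge⇒depth≥2 {x} x<y =
    ≤-trans (s≤s (filterᵇ-nonempty⁺ (_<ᵗ_ T x) (∈-allFin _) x<y)) (pathLength≤depth x)

  depth≥2⇒edge : 2 ≤ depth T → ∃₂ λ x y → _<ᵗ_ T x y ≡ true
  depth≥2⇒edge le with foldr-⊔-attained (pathLength T) (allFin (size T)) le
  ... | x , s≤s ancestor = x , filterᵇ-nonempty⁻ (_<ᵗ_ T x) (allFin (size T)) ancestor

-- Formulas with few quantifiers

⟨_⟩ : A → Fin 1 → A
⟨ x ⟩ = extend x noVars

Assignment : RootedTree → ℕ → Set
Assignment T k = Fin k → Fin (size T)

PartialIso : (T T′ : RootedTree) {k : ℕ} → Assignment T k → Assignment T′ k → Set
PartialIso T T′ ρ σ = ∀ i j →
  (_<ᵗ_ T (ρ i) (ρ j) ≡ _<ᵗ_ T′ (σ i) (σ j)) × (eqFin (ρ i) (ρ j) ≡ eqFin (σ i) (σ j))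

Forth : (T T′ : RootedTree) {k : ℕ} → Assignment T k → Assignment T′ k → Set
Forth T T′ ρ σ = ∀ a → ∃ λ a′ → PartialIso T T′ (extend a ρ) (extend a′ σ)

∀≡not-∃-not : (T : RootedTree) {k : ℕ} (χ : Formula (suc k)) (ρ : Assignment T k) →
              eval T (∀′ χ) ρ ≡ not (eval T (∃′ (¬′ χ)) ρ)
∀≡not-∃-not T χ ρ = all≡not-any-not (λ a → eval T χ (extend a ρ)) (allFin (size T))

-- Universal quantifiers are handled as ¬∃¬, which costs no extra quantifier.
module _ (T T′ : RootedTree) {k : ℕ} {ρ : Assignment T k} {σ : Assignment T′ k}
         (iso : PartialIso T T′ ρ σ) (n : ℕ)
         (∃-cong : ∀ χ → suc (qcount χ) ≤ n → eval T (∃′ χ) ρ ≡ eval T′ (∃′ χ) σ)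
         where

  eval-cong : ∀ φ → qcount φ ≤ n → eval T φ ρ ≡ eval T′ φ σ
  eval-cong₂ : (op : Bool → Bool → Bool) (φ ψ : Formula k) → qcount φ + qcount ψ ≤ n →
               op (eval T φ ρ) (eval T ψ ρ) ≡ op (eval T′ φ σ) (eval T′ ψ σ)
  eval-cong₂ op φ ψ le =
    cong₂ op (eval-cong φ (m+n≤o⇒m≤o _ le)) (eval-cong ψ (m+n≤o⇒n≤o (qcount φ) le))

  eval-cong ⊤′       _  = refl
  eval-cong ⊥′       _  = refl
  eval-cong (x ≺ y)  _  = proj₁ (iso x y)
  eval-cong (x ≐ y)  _  = proj₂ (iso x y)
  eval-cong (¬′ φ)   le = cong not (eval-cong φ le)
  eval-cong (φ ∧′ ψ) le = eval-cong₂ _∧_ φ ψ le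
  eval-cong (φ ∨′ ψ) le = eval-cong₂ _∨_ φ ψ le
  eval-cong (φ ⇒′ ψ) le = eval-cong₂ (λ a b → not a ∨ b) φ ψ le
  eval-cong (φ ⇔′ ψ) le = eval-cong₂ (λ a b → if a then b else not b) φ ψ le
  eval-cong (∃′ χ)   le = ∃-cong χ le
  eval-cong (∀′ χ)   le = begin
    eval T (∀′ χ) ρ                ≡⟨ ∀≡not-∃-not T χ ρ ⟩
    not (eval T (∃′ (¬′ χ)) ρ)     ≡⟨ cong not (∃-cong (¬′ χ) le) ⟩
    not (eval T′ (∃′ (¬′ χ)) σ)    ≡⟨ sym (∀≡not-∃-not T′ χ σ) ⟩
    eval T′ (∀′ χ) σ               ∎
    where open ≡-Reasoning

module _ {T T′ : RootedTree} where

  eval-qfree : ∀ {k} (φ : Formula k) {ρ σ} → qcount φ ≡ 0 → PartialIso T T′ ρ σ →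
               eval T φ ρ ≡ eval T′ φ σ
  eval-qfree φ q iso = eval-cong T T′ iso 0 (λ _ ()) φ (≤-reflexive q)

  ∃-witness-transfer : ∀ {k} (χ : Formula (suc k)) {ρ σ a a′} → qcount χ ≡ 0 →
                       PartialIso T T′ (extend a ρ) (extend a′ σ) →
                       eval T χ (extend a ρ) ≡ true → eval T′ (∃′ χ) σ ≡ true
  ∃-witness-transfer χ {σ = σ} {a′ = a′} q iso χa =
    any≡true⁺ (λ b → eval T′ χ (extend b σ)) (∈-allFin a′)
              (≡-trans (sym (eval-qfree χ q iso)) χa)

  ∃-transfer : ∀ {k} (χ : Formula (suc k)) {ρ σ} → qcount χ ≡ 0 → Forth T T′ ρ σ →
               eval T (∃′ χ) ρ ≡ true → eval T′ (∃′ χ) σ ≡ true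
  ∃-transfer χ q forth h with any≡true⁻ _ (allFin (size T)) h
  ... | a , χa = ∃-witness-transfer χ q (proj₂ (forth a)) χa

eval-≤1 : {T T′ : RootedTree} {k : ℕ} (φ : Formula k) {ρ : Assignment T k} {σ : Assignment T′ k} →
          qcount φ ≤ 1 → PartialIso T T′ ρ σ → Forth T T′ ρ σ → Forth T′ T σ ρ →
          eval T φ ρ ≡ eval T′ φ σ
eval-≤1 {T} {T′} φ {ρ} {σ} le iso forth back = eval-cong T T′ iso 1 ∃-cong φ le
  where
  ∃-cong : ∀ χ → suc (qcount χ) ≤ 1 → eval T (∃′ χ) ρ ≡ eval T′ (∃′ χ) σ
  ∃-cong χ (s≤s le₀) =
    ≡-from-⇔ (∃-transfer χ (n≤0⇒n≡0 le₀) forth) (∃-transfer χ (n≤0⇒n≡0 le₀) back)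

OneOf : Bool → Bool → Bool → Set
OneOf x b t = x ≡ b ⊎ x ≡ t

oneOf-resp : ∀ {x b t x′ b′ t′} → x ≡ x′ → b ≡ b′ → t ≡ t′ → OneOf x b t → OneOf x′ b′ t′
oneOf-resp refl refl refl o = o

oneOf-not : ∀ {x b t} → OneOf x b t → OneOf (not x) (not b) (not t)
oneOf-not (inj₁ e) = inj₁ (cong not e)
oneOf-not (inj₂ e) = inj₂ (cong not e)

oneOf-op : (op : Bool → Bool → Bool) {x b t y b′ t′ : Bool} →
           OneOf x b t → y ≡ b′ → y ≡ t′ → OneOf (op x y) (op b b′) (op t t′)
oneOf-op op (inj₁ e) e₁ _  = inj₁ (cong₂ op e e₁)
oneOf-op op (inj₂ e) _  e₂ = inj₂ (cong₂ op e e₂)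

oneOf-∨ : ∀ {x} b t → x ≡ b ∨ t → OneOf x b t
oneOf-∨ true  _ e = inj₁ e
oneOf-∨ false _ e = inj₂ e

m+n≤1⇒m≡0⊎n≡0 : ∀ m {n} → m + n ≤ 1 → m ≡ 0 ⊎ n ≡ 0
m+n≤1⇒m≡0⊎n≡0 zero    _         = inj₁ refl
m+n≤1⇒m≡0⊎n≡0 (suc m) (s≤s le) = inj₂ (n≤0⇒n≡0 (m+n≤o⇒n≤o m le))

module _ (T : RootedTree) {k : ℕ} {ρ ρ₁ ρ₂ : Assignment T k}
         (iso₁ : PartialIso T T ρ ρ₁) (iso₂ : PartialIso T T ρ ρ₂)
         (∃-split : ∀ χ → qcount χ ≡ 0 →
                    eval T (∃′ χ) ρ ≡ eval T (∃′ χ) ρ₁ ∨ eval T (∃′ χ) ρ₂)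
         where

  oneOf-qfree : ∀ φ → qcount φ ≡ 0 → OneOf (eval T φ ρ) (eval T φ ρ₁) (eval T φ ρ₂)
  oneOf-qfree φ q = inj₁ (eval-qfree φ q iso₁)

  oneOf-∃ : ∀ χ → qcount χ ≡ 0 →
            OneOf (eval T (∃′ χ) ρ) (eval T (∃′ χ) ρ₁) (eval T (∃′ χ) ρ₂)
  oneOf-∃ χ q = oneOf-∨ _ _ (∃-split χ q)

  eval-oneOf : ∀ φ → qcount φ ≤ 1 → OneOf (eval T φ ρ) (eval T φ ρ₁) (eval T φ ρ₂)
  oneOf-op-formula : (op : Bool → Bool → Bool) (φ ψ : Formula k) → qcount φ + qcount ψ ≤ 1 →
    OneOf (op (eval T φ ρ) (eval T ψ ρ)) (op (eval T φ ρ₁) (eval T ψ ρ₁))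
          (op (eval T φ ρ₂) (eval T ψ ρ₂))
  oneOf-op-formula op φ ψ le with m+n≤1⇒m≡0⊎n≡0 (qcount φ) le
  ... | inj₁ qφ = oneOf-op (flip op) (eval-oneOf ψ (m+n≤o⇒n≤o (qcount φ) le))
                    (eval-qfree φ qφ iso₁) (eval-qfree φ qφ iso₂)
  ... | inj₂ qψ = oneOf-op op (eval-oneOf φ (m+n≤o⇒m≤o (qcount φ) le))
                    (eval-qfree ψ qψ iso₁) (eval-qfree ψ qψ iso₂)

  eval-oneOf ⊤′       _  = inj₁ refl
  eval-oneOf ⊥′       _  = inj₁ refl
  eval-oneOf (x ≺ y)  _  = oneOf-qfree (x ≺ y) refl
  eval-oneOf (x ≐ y)  _  = oneOf-qfree (x ≐ y) refl
  eval-oneOf (¬′ φ)   le = oneOf-not (eval-oneOf φ le)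
  eval-oneOf (φ ∧′ ψ) le = oneOf-op-formula _∧_ φ ψ le
  eval-oneOf (φ ∨′ ψ) le = oneOf-op-formula _∨_ φ ψ le
  eval-oneOf (φ ⇒′ ψ) le = oneOf-op-formula (λ a b → not a ∨ b) φ ψ le
  eval-oneOf (φ ⇔′ ψ) le = oneOf-op-formula (λ a b → if a then b else not b) φ ψ le
  eval-oneOf (∃′ χ) (s≤s le) = oneOf-∃ χ (n≤0⇒n≡0 le)
  eval-oneOf (∀′ χ) (s≤s le) =
    oneOf-resp (sym (∀≡not-∃-not T χ ρ)) (sym (∀≡not-∃-not T χ ρ₁))
               (sym (∀≡not-∃-not T χ ρ₂))
      (oneOf-not (oneOf-∃ (¬′ χ) (n≤0⇒n≡0 le)))

∃-split-by-Forth :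
  (T : RootedTree) {k : ℕ} {ρ ρ₁ ρ₂ : Assignment T k} →
  Forth T T ρ₁ ρ → Forth T T ρ₂ ρ →
  (∀ a → (∃ λ a′ → PartialIso T T (extend a ρ) (extend a′ ρ₁)) ⊎
         (∃ λ a′ → PartialIso T T (extend a ρ) (extend a′ ρ₂))) →
  ∀ χ → qcount χ ≡ 0 → eval T (∃′ χ) ρ ≡ eval T (∃′ χ) ρ₁ ∨ eval T (∃′ χ) ρ₂
∃-split-by-Forth T {ρ = ρ} {ρ₁} {ρ₂} forth₁ forth₂ split χ q = ≡-from-⇔ to-∨ from-∨
  where
  to-∨ : eval T (∃′ χ) ρ ≡ true → eval T (∃′ χ) ρ₁ ∨ eval T (∃′ χ) ρ₂ ≡ true
  to-∨ h with any≡true⁻ _ (allFin (size T)) h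
  ... | a , χa with split a
  ... | inj₁ (_ , iso) = cong (_∨ _) (∃-witness-transfer χ q iso χa)
  ... | inj₂ (_ , iso) = ≡-trans (cong (_ ∨_) (∃-witness-transfer χ q iso χa)) (∨-zeroʳ _)
  from-∨ : eval T (∃′ χ) ρ₁ ∨ eval T (∃′ χ) ρ₂ ≡ true → eval T (∃′ χ) ρ ≡ true
  from-∨ h with ∨≡true⁻ (eval T (∃′ χ) ρ₁) h
  ... | inj₁ h₁ = ∃-transfer χ q forth₁ h₁
  ... | inj₂ h₂ = ∃-transfer χ q forth₂ h₂

any-allFin-oneOf : ∀ {n} (f : Fin n → Bool) b t → (∀ x → OneOf (f x) (f b) (f t)) →
                   any f (allFin n) ≡ f b ∨ f t
any-allFin-oneOf {n} f b t oneOf = ≡-from-⇔ to-∨ from-∨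
  where
  to-∨ : any f (allFin n) ≡ true → f b ∨ f t ≡ true
  to-∨ h with any≡true⁻ f (allFin n) h
  ... | x , fx with oneOf x
  ... | inj₁ e = cong (_∨ f t) (≡-trans (sym e) fx)
  ... | inj₂ e = ≡-trans (cong (f b ∨_) (≡-trans (sym e) fx)) (∨-zeroʳ (f b))
  from-∨ : f b ∨ f t ≡ true → any f (allFin n) ≡ true
  from-∨ h with ∨≡true⁻ (f b) h
  ... | inj₁ fb = any≡true⁺ f (∈-allFin b) fb
  ... | inj₂ ft = any≡true⁺ f (∈-allFin t) ft

OneOfEndpoints : (T : RootedTree) → Fin (size T) → Fin (size T) → Set
OneOfEndpoints T b t =
  ∀ ψ → qcount ψ ≤ 1 → ∀ x → OneOf (eval T ψ ⟨ x ⟩) (eval T ψ ⟨ b ⟩) (eval T ψ ⟨ t ⟩)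

sentences-≤2-agree :
  (T T′ : RootedTree) (b t : Fin (size T)) (b′ t′ : Fin (size T′)) →
  OneOfEndpoints T b t → OneOfEndpoints T′ b′ t′ →
  (∀ ψ → qcount ψ ≤ 1 → eval T ψ ⟨ b ⟩ ≡ eval T′ ψ ⟨ b′ ⟩) →
  (∀ ψ → qcount ψ ≤ 1 → eval T ψ ⟨ t ⟩ ≡ eval T′ ψ ⟨ t′ ⟩) →
  ∀ φ → qcount φ ≤ 2 → T ⊨ φ ≡ T′ ⊨ φ
sentences-≤2-agree T T′ b t b′ t′ oneOf oneOf′ agree-b agree-t =
  eval-cong T T′ (λ ()) 2 ∃-cong
  where
  ∃-cong : ∀ ψ → suc (qcount ψ) ≤ 2 → T ⊨ ∃′ ψ ≡ T′ ⊨ ∃′ ψ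
  ∃-cong ψ (s≤s le) = begin
    T ⊨ ∃′ ψ                               ≡⟨ any-allFin-oneOf _ b t (oneOf ψ le) ⟩
    eval T ψ ⟨ b ⟩ ∨ eval T ψ ⟨ t ⟩        ≡⟨ cong₂ _∨_ (agree-b ψ le) (agree-t ψ le) ⟩
    eval T′ ψ ⟨ b′ ⟩ ∨ eval T′ ψ ⟨ t′ ⟩    ≡⟨ sym (any-allFin-oneOf _ b′ t′ (oneOf′ ψ le)) ⟩
    T′ ⊨ ∃′ ψ                              ∎
    where open ≡-Reasoning

-- Chains

<ᵇ≡true : ∀ {m n} → m < n → (m <ᵇ n) ≡ true
<ᵇ≡true m<n = to T-≡ (<⇒<ᵇ m<n)

<ᵇ≡true⁻¹ : ∀ m n → (m <ᵇ n) ≡ true → m < n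
<ᵇ≡true⁻¹ m n e = <ᵇ⇒< m n (from T-≡ e)

<ᵇ≡false : ∀ m n → n ≤ m → (m <ᵇ n) ≡ false
<ᵇ≡false m n n≤m with m <ᵇ n in e
... | false = refl
... | true  = contradiction (<ᵇ≡true⁻¹ m n e) (≤⇒≯ n≤m)

_<ᶜ_ : ∀ {n} → Fin n → Fin n → Bool
x <ᶜ y = toℕ x <ᵇ toℕ y

<ᶜ-irrefl : ∀ {n} (x : Fin n) → x <ᶜ x ≡ false
<ᶜ-irrefl x = <ᵇ≡false (toℕ x) (toℕ x) ≤-refl

<ᶜ-trans : ∀ {n} (x y z : Fin n) → x <ᶜ y ≡ true → y <ᶜ z ≡ true → x <ᶜ z ≡ true
<ᶜ-trans x y z x<y y<z =
  <ᵇ≡true (<-trans (<ᵇ≡true⁻¹ (toℕ x) (toℕ y) x<y) (<ᵇ≡true⁻¹ (toℕ y) (toℕ z) y<z))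

<ᶜ-trichotomous : ∀ {n} (y z : Fin n) → y ≡ z ⊎ (y <ᶜ z ≡ true ⊎ z <ᶜ y ≡ true)
<ᶜ-trichotomous y z with Fin.<-cmp y z
... | tri< y<z _ _ = inj₂ (inj₁ (<ᵇ≡true y<z))
... | tri≈ _ y≡z _ = inj₁ y≡z
... | tri> _ _ z<y = inj₂ (inj₂ (<ᵇ≡true z<y))

<ᶜ-fromℕ : ∀ {n} (x : Fin (suc n)) → x ≢ fromℕ n → x <ᶜ fromℕ n ≡ true
<ᶜ-fromℕ x x≢top = <ᵇ≡true (≤∧≢⇒< (≤fromℕ x) x≢top)

fromℕ-≮ᶜ : ∀ {n} (x : Fin (suc n)) → fromℕ n <ᶜ x ≡ false
fromℕ-≮ᶜ {n} x = <ᵇ≡false (toℕ (fromℕ n)) (toℕ x) (≤fromℕ x)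

eqFin≡not-<ᶜ∨>ᶜ : ∀ {n} (x y : Fin n) → eqFin x y ≡ not (x <ᶜ y ∨ y <ᶜ x)
eqFin≡not-<ᶜ∨>ᶜ zero    zero    = refl
eqFin≡not-<ᶜ∨>ᶜ zero    (suc y) = refl
eqFin≡not-<ᶜ∨>ᶜ (suc x) zero    = refl
eqFin≡not-<ᶜ∨>ᶜ (suc x) (suc y) = eqFin≡not-<ᶜ∨>ᶜ x y

-- The leaf is node 0 and the root is the last node.
chain : ℕ → RootedTree
chain k = record
  { size            = suc k
  ; _<ᵗ_            = _<ᶜ_
  ; irrefl          = <ᶜ-irrefl
  ; trans           = <ᶜ-trans
  ; root            = fromℕ k
  ; root-top        = <ᶜ-fromℕ
  ; ancestors-chain = λ _ y z _ _ → <ᶜ-trichotomous y z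
  }

depth-chain : ∀ k → depth (chain k) ≡ suc k
depth-chain k =
  ≤-antisym (depth≤size (chain k)) (≤-trans leaf-path (pathLength≤depth (chain k) zero))
  where
  above-leaf : Fin k → Fin (suc k)
  above-leaf i = suc i

  -- allFin (suc k) unfolds to zero ∷ tabulate suc, and every suc i is above zero.
  leaf-path : suc k ≤ pathLength (chain k) zero
  leaf-path = s≤s (≤-reflexive (sym (≡-trans
    (cong length (filter-all (λ y → T? (zero <ᶜ y)) {tabulate above-leaf}
                             (tabulate⁺ (λ _ → _))))
    (length-tabulate above-leaf))))

SameOrder : ∀ {k m n} → (Fin k → Fin m) → (Fin k → Fin n) → Set
SameOrder ρ σ = ∀ i j → ρ i <ᶜ ρ j ≡ σ i <ᶜ σ j

-- In a chain, equality is definable from the order.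
sameOrder⇒partialIso : ∀ {k m n} {ρ : Fin k → Fin (suc m)} {σ : Fin k → Fin (suc n)} →
                       SameOrder ρ σ → PartialIso (chain m) (chain n) ρ σ
sameOrder⇒partialIso {ρ = ρ} {σ} same i j = same i j , (begin
  eqFin (ρ i) (ρ j)                      ≡⟨ eqFin≡not-<ᶜ∨>ᶜ (ρ i) (ρ j) ⟩
  not (ρ i <ᶜ ρ j ∨ ρ j <ᶜ ρ i)          ≡⟨ cong not (cong₂ _∨_ (same i j) (same j i)) ⟩
  not (σ i <ᶜ σ j ∨ σ j <ᶜ σ i)          ≡⟨ sym (eqFin≡not-<ᶜ∨>ᶜ (σ i) (σ j)) ⟩
  eqFin (σ i) (σ j)                      ∎)
  where open ≡-Reasoning

<ᶜ-irrefl-≡ : ∀ {m n} (x : Fin m) (x′ : Fin n) → x <ᶜ x ≡ x′ <ᶜ x′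
<ᶜ-irrefl-≡ x x′ = ≡-trans (<ᶜ-irrefl x) (sym (<ᶜ-irrefl x′))

sameOrder-⟨⟩ : ∀ {m n} {x : Fin m} {x′ : Fin n} → SameOrder ⟨ x ⟩ ⟨ x′ ⟩
sameOrder-⟨⟩ {x = x} {x′} zero zero = <ᶜ-irrefl-≡ x x′

sameOrder-pair : ∀ {m n} {a x : Fin m} {a′ x′ : Fin n} →
                 a <ᶜ x ≡ a′ <ᶜ x′ → x <ᶜ a ≡ x′ <ᶜ a′ →
                 SameOrder (extend a ⟨ x ⟩) (extend a′ ⟨ x′ ⟩)
sameOrder-pair {a = a} {a′ = a′} _ _ zero       zero       = <ᶜ-irrefl-≡ a a′
sameOrder-pair                   p _ zero       (suc zero) = p
sameOrder-pair                   _ q (suc zero) zero       = q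
sameOrder-pair {x = x} {x′ = x′} _ _ (suc zero) (suc zero) = <ᶜ-irrefl-≡ x x′

module _ {m n : ℕ} where

  pairIso : {a x : Fin (suc m)} {a′ x′ : Fin (suc n)} →
            a <ᶜ x ≡ a′ <ᶜ x′ → x <ᶜ a ≡ x′ <ᶜ a′ →
            PartialIso (chain m) (chain n) (extend a ⟨ x ⟩) (extend a′ ⟨ x′ ⟩)
  pairIso {a} {x} {a′} {x′} p q =
    sameOrder⇒partialIso {ρ = extend a ⟨ x ⟩} {extend a′ ⟨ x′ ⟩} (sameOrder-pair p q)

  diagIso : {x : Fin (suc m)} {x′ : Fin (suc n)} →
            PartialIso (chain m) (chain n) (extend x ⟨ x ⟩) (extend x′ ⟨ x′ ⟩)
  diagIso {x} {x′} = pairIso (<ᶜ-irrefl-≡ x x′) (<ᶜ-irrefl-≡ x x′)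

  singleIso : {x : Fin (suc m)} {x′ : Fin (suc n)} → PartialIso (chain m) (chain n) ⟨ x ⟩ ⟨ x′ ⟩
  singleIso {x} {x′} = sameOrder⇒partialIso {ρ = ⟨ x ⟩} {⟨ x′ ⟩} sameOrder-⟨⟩

forth-leaf : ∀ m n → Forth (chain (suc m)) (chain (suc n)) ⟨ zero ⟩ ⟨ zero ⟩
forth-leaf m n zero    = zero , diagIso
forth-leaf m n (suc a) = fromℕ (suc n) , pairIso refl refl

forth-top : ∀ m n → Forth (chain (suc m)) (chain (suc n)) ⟨ fromℕ (suc m) ⟩ ⟨ fromℕ (suc n) ⟩
forth-top m n a with a ≟ fromℕ (suc m)
... | yes refl  = fromℕ (suc n) , diagIso
... | no a≢top = zero , pairIso (<ᶜ-fromℕ a a≢top) (fromℕ-≮ᶜ a)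

chain-oneOfEndpoints : ∀ j → OneOfEndpoints (chain (suc j)) zero (fromℕ (suc j))
chain-oneOfEndpoints j _ _  zero    = inj₁ refl
chain-oneOfEndpoints j ψ le (suc y) with suc y ≟ fromℕ (suc j)
... | yes refl = inj₂ refl
... | no x≢top  =
  eval-oneOf C singleIso singleIso (∃-split-by-Forth C forth-from-leaf forth-from-top split) ψ le
  where
  C : RootedTree
  C = chain (suc j)

  x top : Fin (suc (suc j))
  x = suc y
  top = fromℕ (suc j)

  forth-from-leaf : Forth C C ⟨ zero ⟩ ⟨ x ⟩
  forth-from-leaf zero    = x , diagIso
  forth-from-leaf (suc a) = top , pairIso (sym (fromℕ-≮ᶜ x)) (sym (<ᶜ-fromℕ x x≢top))

  forth-from-top : Forth C C ⟨ top ⟩ ⟨ x ⟩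
  forth-from-top a with a ≟ top
  ... | yes refl  = x , diagIso
  ... | no a≢top = zero , pairIso (<ᶜ-fromℕ a a≢top) (fromℕ-≮ᶜ a)

  split : ∀ a → (∃ λ a′ → PartialIso C C (extend a ⟨ x ⟩) (extend a′ ⟨ zero ⟩)) ⊎
                (∃ λ a′ → PartialIso C C (extend a ⟨ x ⟩) (extend a′ ⟨ top ⟩))
  split a with Fin.<-cmp a x
  ... | tri< a<x _ _  =
    inj₂ (zero , pairIso (<ᵇ≡true a<x) (<ᵇ≡false (toℕ x) (toℕ a) (<⇒≤ a<x)))
  ... | tri≈ _ refl _ = inj₁ (zero , diagIso)
  ... | tri> _ _ x<a  =
    inj₁ (top , pairIso (<ᵇ≡false (toℕ a) (toℕ x) (<⇒≤ x<a)) (<ᵇ≡true x<a))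

chains-agree : ∀ m n φ → qcount φ ≤ 2 → chain (suc m) ⊨ φ ≡ chain (suc n) ⊨ φ
chains-agree m n = sentences-≤2-agree (chain (suc m)) (chain (suc n))
  zero (fromℕ (suc m)) zero (fromℕ (suc n)) (chain-oneOfEndpoints m) (chain-oneOfEndpoints n)
  (λ ψ le → eval-≤1 ψ le singleIso (forth-leaf m n) (forth-leaf n m))
  (λ ψ le → eval-≤1 ψ le singleIso (forth-top m n) (forth-top n m))

hasEdge : Sentence
hasEdge = ∃′ (∃′ (zero ≺ suc zero))

hasEdge-defines-depth≥2 : DefinesDepthAtLeast hasEdge 2
hasEdge-defines-depth≥2 T = deep , shallow
  where
  deep : 2 ≤ depth T → T ⊨ hasEdge ≡ true
  deep le with depth≥2⇒edge T le
  ... | x , y , x<y = any≡true⁺ _ (∈-allFin y) (any≡true⁺ (λ b → _<ᵗ_ T b y) (∈-allFin x) x<y)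

  edge : T ⊨ hasEdge ≡ true → 2 ≤ depth T
  edge holds with any≡true⁻ _ (allFin (size T)) holds
  ... | y , ∃x with any≡true⁻ (λ b → _<ᵗ_ T b y) (allFin (size T)) ∃x
  ... | x , x<y = edge⇒depth≥2 T x<y

  shallow : depth T < 2 → T ⊨ hasEdge ≡ false
  shallow lt = ¬-not (λ holds → ≤⇒≯ (edge holds) lt)

achievable⇒≤2 : ∀ z → Achievable 2 z → z ≤ 2
achievable⇒≤2 0 _ = z≤n
achievable⇒≤2 1 _ = s≤s z≤n
achievable⇒≤2 2 _ = ≤-refl
achievable⇒≤2 (suc (suc (suc j))) (φ , q , defines) =
  contradiction (≡-trans (sym shallow) (≡-trans (chains-agree j (suc j) φ (≤-reflexive q)) deep))
                λ ()
  where
  shallow : chain (suc j) ⊨ φ ≡ false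
  shallow = proj₂ (defines (chain (suc j))) (≤-reflexive (cong suc (depth-chain (suc j))))
  deep : chain (suc (suc j)) ⊨ φ ≡ true
  deep = proj₁ (defines (chain (suc (suc j)))) (≤-reflexive (sym (depth-chain (suc (suc j)))))

lemma3p8 : IsT 2 2
lemma3p8 = (hasEdge , refl , hasEdge-defines-depth≥2) , achievable⇒≤2
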